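{- Let $r\geqslant 0$ and $n\geqslant 2$ be integers with $n\geqslant 2r$. Then there exists $\pi\in\mathrm{Sym}_n$ all of whose cycles of length at least two have length two or three, such that $I(n,2r,r)=|B_r(\pi)\cap B_r(I_n)|$.
   Context: $\mathrm{Sym}_n$ is the symmetric group on $[n]=\{1,\dots,n\}$, $I_n$ its identity, $d(\pi,\tau)=|\{i\in[n]:\pi(i)\neq\tau(i)\}|$ the Hamming distance, $B_r(\pi)=\{\sigma\in\mathrm{Sym}_n:d(\pi,\sigma)\leqslant r\}$, and $I(n,d,r)=\max\{|B_r(\pi)\cap B_r(\tau)| : \pi,\tau\in\mathrm{Sym}_n,\ d(\pi,\tau)=d\}$. -}

module Defs where

open import Data.Nat using (ℕ; zero; suc; _≤_; _⊔_)
open import Data.Fin using (Fin)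
open import Data.Fin.Properties using (_≟_)
open import Data.Vec using (Vec; []; _∷_; lookup; tabulate; toList)
open import Data.List using (List; []; _∷_; map; concatMap; allFin; filter; length; foldr; cartesianProduct)
open import Data.List.Relation.Unary.Unique.Propositional using (Unique)
import Data.List.Relation.Unary.Unique.DecPropositional as UD
open import Data.Product using (Σ; ∃; _×_; _,_; proj₁)
open import Data.Nat.Properties using (_≤?_) renaming (_≟_ to _≟ℕ_)
open import Function using (id)
open import Relation.Nullary using (¬?)
open import Relation.Binary.PropositionalEquality using (_≡_)

allVecs : (n m : ℕ) → List (Vec (Fin n) m)
allVecs n zero    = [] ∷ []
allVecs n (suc m) = concatMap (λ x → map (x ∷_) (allVecs n m)) (allFin n)

-- A permutation of [n] is represented by its one-line notation
-- (π(1),…,π(n)), a vector of length n with pairwise distinct entries.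
IsPerm : {n : ℕ} → Vec (Fin n) n → Set
IsPerm v = Unique (toList v)

SymList : (n : ℕ) → List (Vec (Fin n) n)
SymList n = filter (λ v → UD.unique? _≟_ (toList v)) (allVecs n n)

idPerm : (n : ℕ) → Vec (Fin n) n
idPerm n = tabulate id

dist : {n : ℕ} → Vec (Fin n) n → Vec (Fin n) n → ℕ
dist {n} π τ = length (filter (λ i → ¬? (lookup π i ≟ lookup τ i)) (allFin n))

ballInter : {n : ℕ} → ℕ → Vec (Fin n) n → Vec (Fin n) n → ℕ
ballInter {n} r π τ =
  length (filter (λ σ → dist π σ ≤? r) (filter (λ σ → dist τ σ ≤? r) (SymList n)))

maxList : List ℕ → ℕ
maxList = foldr _⊔_ 0

I : ℕ → ℕ → ℕ → ℕ
I n d r =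
  maxList (map (λ p → ballInter r (proj₁ p) (Data.Product.proj₂ p))
               (filter (λ p → dist (proj₁ p) (Data.Product.proj₂ p) ≟ℕ d)
                       (cartesianProduct (SymList n) (SymList n))))

iter : {n : ℕ} → ℕ → Vec (Fin n) n → Fin n → Fin n
iter zero    π i = i
iter (suc k) π i = lookup π (iter k π i)

-- Every cycle of π of length at least two has length two or three,
-- i.e. every cycle has length 1, 2 or 3: the cycle through each i closes
-- after k steps for some 1 ≤ k ≤ 3.
ShortCycles : {n : ℕ} → Vec (Fin n) n → Set
ShortCycles π = ∀ i → ∃ λ k → 1 ≤ k × k ≤ 3 × iter k π i ≡ i

-- Left multiplication by τ⁻¹ preserves Hamming distance, so I(n,2r,r) is attained at a pair
-- (μ, I_n) with d(μ, I_n) = 2r. A permutation σ in B_r(μ) ∩ B_r(I_n) then satisfies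
-- d(μ,σ) + d(σ,I_n) ≤ d(μ,I_n), which forces σ(x) ∈ {x, μ(x)} at every x; as σ is a bijection,
-- σ either agrees with μ on a whole cycle of μ or fixes it pointwise.
-- If μ has a cycle i → a → b → ⋯ of length at least four, then μ′ = (i b)∘μ splits off the
-- 2-cycle (i a) and has the same fixed points as μ, and σ ↦ (i b)∘σ (for σ containing that
-- cycle; σ ↦ σ otherwise) injects B_r(μ) ∩ B_r(I_n) into B_r(μ′) ∩ B_r(I_n). Every split
-- increases the number of points fixed by μ², so finitely many splits leave only cycles of
-- length at most three without decreasing |B_r(μ) ∩ B_r(I_n)|.

module Submission where

open import Defs

open import Data.Nat using (ℕ; zero; suc; s≤s⁻¹; _*_; _≤_; _<_; _+_; _⊔_; s≤s; z≤n)
open import Data.Nat.Properties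
open import Data.List as List using (List; []; _∷_; filter; length; map)
import Data.List.Properties as Listₚ
open import Data.List.Membership.Propositional using (_∈_)
open import Data.List.Membership.Propositional.Properties
  using (∈-filter⁻; ∈-filter⁺; ∈-map⁺; ∈-map⁻; ∈-lookup; ∈-allFin;
         ∈-cartesianProductWith⁺; ∈-cartesianProduct⁺; ∈-cartesianProduct⁻)
open import Data.List.Relation.Unary.Any as Any using (Any; here; there)
import Data.List.Relation.Unary.Any.Properties as Any
import Data.List.Relation.Unary.All as All
import Data.List.Relation.Unary.All.Properties as All
open import Data.List.Relation.Unary.Unique.Propositional using (Unique)
open import Data.List.Relation.Unary.AllPairs using ([]; _∷_)
import Data.List.Relation.Unary.Unique.Propositional.Properties as Unique
open import Data.List.Relation.Binary.Sublist.Propositional as Sublist using (⊆-refl)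
import Data.List.Relation.Binary.Sublist.Propositional.Properties as Sublist
open import Data.List.Relation.Binary.Pointwise using (Pointwise-≡⇒≡)
open import Data.Fin as Fin using (Fin; toℕ)
open import Data.Fin.Permutation.Components using (transpose)
open import Data.Vec using (Vec; []; _∷_; lookup; tabulate; toList)
import Data.Vec.Properties as Vecₚ
import Data.Vec.Relation.Unary.All.Properties as Vecᵃ
import Data.Vec.Relation.Unary.Unique.Propositional as Vecᵘ
import Data.Vec.Relation.Unary.Unique.Propositional.Properties as Vecᵘ
open import Data.Vec.Relation.Unary.AllPairs using ([]; _∷_)
import Data.Fin.Properties as Finₚ
open import Data.Empty using (⊥-elim)
open import Data.Product using (Σ; _×_; _,_; proj₁; proj₂; ∃; ∃₂)
open import Relation.Nullary using (¬_; ¬?; yes; no)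
import Data.Sum
open import Data.Sum using (_⊎_; inj₁; inj₂; [_,_]′)
open import Relation.Unary using (Pred; Decidable; _⊆_)
open import Relation.Unary.Properties using (_∪?_; _∩?_)
open import Relation.Binary.PropositionalEquality
open import Level using (0ℓ)
open import Function using (_∘_; id; _⇔_; mk⇔; Equivalence)

module _ {A : Set} {P Q : Pred A 0ℓ} (P? : Decidable P) (Q? : Decidable Q) where

  filter-sublist : P ⊆ Q → ∀ xs → filter P? xs Sublist.⊆ filter Q? xs
  filter-sublist P⊆Q xs = Sublist.filter⁺ P? Q? {as = xs} (λ { refl → P⊆Q }) ⊆-refl

  length-filter-mono : P ⊆ Q → ∀ xs → length (filter P? xs) ≤ length (filter Q? xs)
  length-filter-mono P⊆Q xs = Sublist.length-mono-≤ (filter-sublist P⊆Q xs)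

  length-filter-mono-< : P ⊆ Q → ∀ {x xs} → x ∈ xs → Q x → ¬ P x →
    length (filter P? xs) < length (filter Q? xs)
  length-filter-mono-< P⊆Q {x} {xs} x∈xs qx ¬px = ≤∧≢⇒< (length-filter-mono P⊆Q xs) λ eq →
    ¬px (proj₂ (∈-filter⁻ P? {xs = xs} (subst (x ∈_) (sym (filters-equal eq)) (∈-filter⁺ Q? x∈xs qx))))
    where
    -- a sublist of the same length is the whole list
    filters-equal : length (filter P? xs) ≡ length (filter Q? xs) → filter P? xs ≡ filter Q? xs
    filters-equal eq = Pointwise-≡⇒≡ {x = filter P? xs} (Sublist.to-≋ eq (filter-sublist P⊆Q xs))

  length-filter-∪-∩ : ∀ xs → length (filter (P? ∪? Q?) xs) + length (filter (P? ∩? Q?) xs)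
                            ≡ length (filter P? xs) + length (filter Q? xs)
  length-filter-∪-∩ [] = refl
  length-filter-∪-∩ (x ∷ xs) with ih ← length-filter-∪-∩ xs | P? x | Q? x
  ... | yes _ | yes _ = cong suc (trans (+-suc _ _) (trans (cong suc ih) (sym (+-suc _ _))))
  ... | yes _ | no _ = cong suc ih
  ... | no _ | yes _ = trans (cong suc ih) (sym (+-suc _ _))
  ... | no _ | no _ = ih

module _ {A : Set} where

  Unique-lookup-injective : ∀ {xs : List A} → Unique xs →
    ∀ {i j} → List.lookup xs i ≡ List.lookup xs j → i ≡ j
  Unique-lookup-injective {_ ∷ _}  _          {Fin.zero} {Fin.zero}  _  = refl
  Unique-lookup-injective {_ ∷ xs} (x∉ ∷ _)   {Fin.zero} {Fin.suc j} eq = ⊥-elim (All.lookup x∉ (∈-lookup j) eq)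
  Unique-lookup-injective {_ ∷ xs} (x∉ ∷ _)   {Fin.suc i} {Fin.zero} eq = ⊥-elim (All.lookup x∉ (∈-lookup i) (sym eq))
  Unique-lookup-injective {_ ∷ xs} (_ ∷ uxs)  {Fin.suc i} {Fin.suc j} eq = cong Fin.suc (Unique-lookup-injective uxs eq)

module _ {A B : Set} where

  length-≤-by-injection : ∀ {xs : List A} {ys : List B} (f : A → B) → Unique xs →
    (∀ {a b} → a ∈ xs → b ∈ xs → f a ≡ f b → a ≡ b) → (∀ {a} → a ∈ xs → f a ∈ ys) →
    length xs ≤ length ys
  length-≤-by-injection {xs} {ys} f uxs f-inj f-into = Finₚ.injective⇒≤ position-injective
    where
    position : Fin (length xs) → Fin (length ys)
    position k = Any.index (f-into (∈-lookup k))
    position-injective : ∀ {k l} → position k ≡ position l → k ≡ l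
    position-injective {k} {l} eq = Unique-lookup-injective uxs (f-inj (∈-lookup k) (∈-lookup l) (begin
      f (List.lookup xs k)                   ≡⟨ Any.lookup-index (f-into (∈-lookup k)) ⟩
      List.lookup ys (position k)            ≡⟨ cong (List.lookup ys) eq ⟩
      List.lookup ys (position l)            ≡⟨ Any.lookup-index (f-into (∈-lookup l)) ⟨
      f (List.lookup xs l)                   ∎))
      where open ≡-Reasoning

module _ {A : Set} {P : Pred A 0ℓ} (P? : Decidable P) where

  length-filter-tabulate-initial : ∀ {n m} (g : Fin n → A) → m ≤ n →
    (∀ x → P (g x) → toℕ x < m) → (∀ x → toℕ x < m → P (g x)) →
    length (filter P? (List.tabulate g)) ≡ m
  length-filter-tabulate-initial {zero}  {zero}  g _ _ _ = refl
  length-filter-tabulate-initial {suc n} {zero}  g _ below _ =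
    cong length (Listₚ.filter-none P? (All.tabulate⁺ (λ x p → n≮0 (below x p))))
  length-filter-tabulate-initial {suc n} {suc m} g (s≤s m≤n) below above with P? (g Fin.zero)
  ... | yes _ = cong suc (length-filter-tabulate-initial (g ∘ Fin.suc) m≤n
                  (λ x p → s≤s⁻¹ (below (Fin.suc x) p)) (λ x x<m → above (Fin.suc x) (s≤s x<m)))
  ... | no ¬p = ⊥-elim (¬p (above Fin.zero (s≤s z≤n)))

concatMap-map≡cartesianProductWith : ∀ {A B C : Set} (f : A → B → C) xs ys →
  List.concatMap (λ x → map (f x) ys) xs ≡ List.cartesianProductWith f xs ys
concatMap-map≡cartesianProductWith f []       ys = refl
concatMap-map≡cartesianProductWith f (x ∷ xs) ys =
  cong (map (f x) ys List.++_) (concatMap-map≡cartesianProductWith f xs ys)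

injective⇒surjective : ∀ {n} {f : Fin n → Fin n} → (∀ {i j} → f i ≡ f j → i ≡ j) →
  ∀ j → ∃ λ i → f i ≡ j
injective⇒surjective {suc _} {f} f-inj j with Finₚ.any? (λ i → f i Finₚ.≟ j)
... | yes found = found
... | no ¬found = ⊥-elim (<-irrefl refl (Finₚ.injective⇒≤ punched-injective))
  where
  -- without a preimage of j, punching j out of f embeds Fin n into Fin (n - 1)
  f≢j : ∀ i → j ≢ f i
  f≢j i j≡fi = ¬found (i , sym j≡fi)
  punched-injective : ∀ {a b} → Fin.punchOut (f≢j a) ≡ Fin.punchOut (f≢j b) → a ≡ b
  punched-injective eq = f-inj (Finₚ.punchOut-injective (f≢j _) (f≢j _) eq)

Perm : ℕ → Set
Perm n = Vec (Fin n) n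

module _ {A : Set} where

  Unique-toList⁻ : ∀ {n} {v : Vec A n} → Unique (toList v) → Vecᵘ.Unique v
  Unique-toList⁻ {v = []}    []         = []
  Unique-toList⁻ {v = _ ∷ _} (x∉ ∷ uv) = Vecᵃ.toList⁻ x∉ ∷ Unique-toList⁻ uv

  Unique-toList⁺ : ∀ {n} {v : Vec A n} → Vecᵘ.Unique v → Unique (toList v)
  Unique-toList⁺ []         = []
  Unique-toList⁺ (x∉ ∷ uv) = Vecᵃ.toList⁺ x∉ ∷ Unique-toList⁺ uv

  lookup-ext : ∀ {n} (u v : Vec A n) → (∀ i → lookup u i ≡ lookup v i) → u ≡ v
  lookup-ext u v eq = trans (sym (Vecₚ.tabulate∘lookup u)) (trans (Vecₚ.tabulate-cong eq) (Vecₚ.tabulate∘lookup v))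

module _ {n : ℕ} where

  IsPerm-injective : {v : Perm n} → IsPerm v → ∀ {i j} → lookup v i ≡ lookup v j → i ≡ j
  IsPerm-injective pv = Vecᵘ.lookup-injective (Unique-toList⁻ pv) _ _

  tabulate-IsPerm : {f : Fin n → Fin n} → (∀ {i j} → f i ≡ f j → i ≡ j) → IsPerm (tabulate f)
  tabulate-IsPerm f-inj = Unique-toList⁺ (Vecᵘ.tabulate⁺ f-inj)

  idPerm-IsPerm : IsPerm (idPerm n)
  idPerm-IsPerm = tabulate-IsPerm id

  lookup-idPerm : ∀ x → lookup (idPerm n) x ≡ x
  lookup-idPerm = Vecₚ.lookup∘tabulate id

module _ {n : ℕ} {v : Perm n} (pv : IsPerm v) where

  inverse : Fin n → Fin n
  inverse j = proj₁ (injective⇒surjective (IsPerm-injective pv) j)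

  inverseʳ : ∀ j → lookup v (inverse j) ≡ j
  inverseʳ j = proj₂ (injective⇒surjective (IsPerm-injective pv) j)

  inverseˡ : ∀ i → inverse (lookup v i) ≡ i
  inverseˡ i = IsPerm-injective pv (inverseʳ (lookup v i))

  inverse-injective : ∀ {i j} → inverse i ≡ inverse j → i ≡ j
  inverse-injective {i} {j} eq = trans (sym (inverseʳ i)) (trans (cong (lookup v) eq) (inverseʳ j))

allVecs-suc : ∀ n m → allVecs n (suc m) ≡ List.cartesianProductWith _∷_ (List.allFin n) (allVecs n m)
allVecs-suc n m = concatMap-map≡cartesianProductWith _∷_ (List.allFin n) (allVecs n m)

allVecs-Unique : ∀ n m → Unique (allVecs n m)
allVecs-Unique n zero    = All.[] ∷ []
allVecs-Unique n (suc m) = subst Unique (sym (allVecs-suc n m))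
  (Unique.cartesianProductWith⁺ _∷_ Vecₚ.∷-injective (Unique.allFin⁺ n) (allVecs-Unique n m))

∈-allVecs : ∀ {n m} (v : Vec (Fin n) m) → v ∈ allVecs n m
∈-allVecs []      = here refl
∈-allVecs {n} {suc m} (x ∷ v) = subst ((x ∷ v) ∈_) (sym (allVecs-suc n m))
  (∈-cartesianProductWith⁺ _∷_ (∈-allFin x) (∈-allVecs v))

module _ {n : ℕ} where

  SymList-Unique : Unique (SymList n)
  SymList-Unique = Unique.filter⁺ _ (allVecs-Unique n n)

  ∈-SymList⁺ : {v : Perm n} → IsPerm v → v ∈ SymList n
  ∈-SymList⁺ {v} = ∈-filter⁺ _ (∈-allVecs v)

  ∈-SymList⁻ : {v : Perm n} → v ∈ SymList n → IsPerm v
  ∈-SymList⁻ v∈ = proj₂ (∈-filter⁻ _ {xs = allVecs n n} v∈)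

-- Hamming distance

module _ {n : ℕ} where

  dist-cong : ∀ (a b c d : Perm n) → (∀ x → (lookup a x ≡ lookup b x) ⇔ (lookup c x ≡ lookup d x)) →
    dist a b ≡ dist c d
  dist-cong a b c d agree = cong length (Listₚ.filter-≐ _ _
    ((λ {x} a≢b c≡d → a≢b (Equivalence.from (agree x) c≡d)) ,
     (λ {x} c≢d a≡b → c≢d (Equivalence.to (agree x) a≡b)))
    (List.allFin n))

  dist-sym : ∀ (a b : Perm n) → dist a b ≡ dist b a
  dist-sym a b = dist-cong a b b a (λ _ → mk⇔ sym sym)

  dist-id-cong : ∀ (a b : Perm n) → (∀ x → (lookup a x ≡ x) ⇔ (lookup b x ≡ x)) →
    dist (idPerm n) a ≡ dist (idPerm n) b
  dist-id-cong a b same-fixed = dist-cong (idPerm n) a (idPerm n) b agree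
    where
    agree : ∀ x → (lookup (idPerm n) x ≡ lookup a x) ⇔ (lookup (idPerm n) x ≡ lookup b x)
    agree x rewrite lookup-idPerm x =
      mk⇔ (sym ∘ Equivalence.to (same-fixed x) ∘ sym) (sym ∘ Equivalence.from (same-fixed x) ∘ sym)

  dist-<-triangle : ∀ (a b c : Perm n) x → lookup a x ≢ lookup b x → lookup b x ≢ lookup c x →
    dist a c < dist a b + dist b c
  dist-<-triangle a b c x a≢b b≢c = begin-strict
    dist a c                                 <⟨ m<m+n (dist a c) (Listₚ.filter-some (P? ∩? Q?) x∈both) ⟩
    dist a c + length (filter (P? ∩? Q?) xs) ≤⟨ +-monoˡ-≤ _ (length-filter-mono R? (P? ∪? Q?) R⊆P∪Q xs) ⟩
    length (filter (P? ∪? Q?) xs) + length (filter (P? ∩? Q?) xs) ≡⟨ length-filter-∪-∩ P? Q? xs ⟩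
    dist a b + dist b c                      ∎
    where
    open ≤-Reasoning
    xs = List.allFin n
    P? = λ i → ¬? (lookup a i Finₚ.≟ lookup b i)
    Q? = λ i → ¬? (lookup b i Finₚ.≟ lookup c i)
    R? = λ i → ¬? (lookup a i Finₚ.≟ lookup c i)
    R⊆P∪Q : ∀ {i} → lookup a i ≢ lookup c i → lookup a i ≢ lookup b i ⊎ lookup b i ≢ lookup c i
    R⊆P∪Q {i} a≢c with lookup a i Finₚ.≟ lookup b i
    ... | no a≢b = inj₁ a≢b
    ... | yes a≡b = inj₂ (λ b≡c → a≢c (trans a≡b b≡c))
    x∈both : Any (λ i → lookup a i ≢ lookup b i × lookup b i ≢ lookup c i) xs
    x∈both = Any.map (λ { refl → a≢b , b≢c }) (∈-allFin x)

  geodesic⇒between : ∀ (a b c : Perm n) → dist a b + dist b c ≤ dist a c →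
    ∀ x → lookup b x ≡ lookup a x ⊎ lookup b x ≡ lookup c x
  geodesic⇒between a b c geodesic x with lookup b x Finₚ.≟ lookup a x | lookup b x Finₚ.≟ lookup c x
  ... | yes b≡a | _     = inj₁ b≡a
  ... | no _    | yes b≡c = inj₂ b≡c
  ... | no b≢a  | no b≢c  = ⊥-elim (<⇒≱ (dist-<-triangle a b c x (b≢a ∘ sym) b≢c) geodesic)

-- Intersections of balls

module _ {n : ℕ} (r : ℕ) where

  InBalls : Perm n → Perm n → Perm n → Set
  InBalls π τ σ = IsPerm σ × dist π σ ≤ r × dist τ σ ≤ r

  private
    ballList : Perm n → Perm n → List (Perm n)
    ballList π τ = filter (λ σ → dist π σ ≤? r) (filter (λ σ → dist τ σ ≤? r) (SymList n))

    ∈-ballList⁻ : ∀ π τ {σ} → σ ∈ ballList π τ → InBalls π τ σ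
    ∈-ballList⁻ π τ σ∈ =
      let σ∈τ , π-close = ∈-filter⁻ (λ σ → dist π σ ≤? r) {xs = filter (λ σ → dist τ σ ≤? r) (SymList n)} σ∈
          σ∈Sym , τ-close = ∈-filter⁻ (λ σ → dist τ σ ≤? r) {xs = SymList n} σ∈τ
      in ∈-SymList⁻ σ∈Sym , π-close , τ-close

    ∈-ballList⁺ : ∀ π τ {σ} → InBalls π τ σ → σ ∈ ballList π τ
    ∈-ballList⁺ π τ (pσ , π-close , τ-close) = ∈-filter⁺ _ (∈-filter⁺ _ (∈-SymList⁺ pσ) τ-close) π-close

  sphere-InBalls⇒between : ∀ {μ σ} → dist (idPerm n) μ ≡ 2 * r → InBalls μ (idPerm n) σ →
    ∀ x → lookup σ x ≡ lookup μ x ⊎ lookup σ x ≡ x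
  sphere-InBalls⇒between {μ} {σ} on-sphere (_ , μ-close , id-close) x =
    Data.Sum.map₂ (λ σx≡x → trans σx≡x (lookup-idPerm x))
      (geodesic⇒between μ σ (idPerm n) geodesic x)
    where
    open ≤-Reasoning
    geodesic : dist μ σ + dist σ (idPerm n) ≤ dist μ (idPerm n)
    geodesic = begin
      dist μ σ + dist σ (idPerm n)  ≤⟨ +-mono-≤ μ-close (subst (_≤ r) (dist-sym (idPerm n) σ) id-close) ⟩
      r + r                         ≡⟨ cong (r +_) (+-identityʳ r) ⟨
      2 * r                         ≡⟨ on-sphere ⟨
      dist (idPerm n) μ             ≡⟨ dist-sym (idPerm n) μ ⟩
      dist μ (idPerm n)             ∎

  ballInter-≤-by-injection : ∀ π τ π′ τ′ (G : Perm n → Perm n) →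
    (∀ {σ} → InBalls π τ σ → InBalls π′ τ′ (G σ)) →
    (∀ {σ σ′} → InBalls π τ σ → InBalls π τ σ′ → G σ ≡ G σ′ → σ ≡ σ′) →
    ballInter r π τ ≤ ballInter r π′ τ′
  ballInter-≤-by-injection π τ π′ τ′ G G-into G-inj =
    length-≤-by-injection {xs = ballList π τ} {ys = ballList π′ τ′} G
    (Unique.filter⁺ _ (Unique.filter⁺ _ SymList-Unique))
    (λ σ∈ σ′∈ → G-inj (∈-ballList⁻ π τ σ∈) (∈-ballList⁻ π τ σ′∈))
    (λ σ∈ → ∈-ballList⁺ π′ τ′ (G-into (∈-ballList⁻ π τ σ∈)))

module _ {n : ℕ} {τ : Perm n} (pτ : IsPerm τ) where

  translate : Perm n → Perm n
  translate σ = tabulate (inverse pτ ∘ lookup σ)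

  private
    lookup-translate : ∀ σ x → lookup (translate σ) x ≡ inverse pτ (lookup σ x)
    lookup-translate σ = Vecₚ.lookup∘tabulate (inverse pτ ∘ lookup σ)

  translate-IsPerm : ∀ {σ} → IsPerm σ → IsPerm (translate σ)
  translate-IsPerm pσ = tabulate-IsPerm (IsPerm-injective pσ ∘ inverse-injective pτ)

  translate-injective : ∀ {σ σ′} → translate σ ≡ translate σ′ → σ ≡ σ′
  translate-injective {σ} {σ′} eq = lookup-ext σ σ′ λ x → inverse-injective pτ (begin
    inverse pτ (lookup σ x)   ≡⟨ lookup-translate σ x ⟨
    lookup (translate σ) x    ≡⟨ cong (λ v → lookup v x) eq ⟩
    lookup (translate σ′) x   ≡⟨ lookup-translate σ′ x ⟩
    inverse pτ (lookup σ′ x)  ∎)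
    where open ≡-Reasoning

  dist-translate : ∀ σ σ′ → dist (translate σ) (translate σ′) ≡ dist σ σ′
  dist-translate σ σ′ = dist-cong (translate σ) (translate σ′) σ σ′ λ x → mk⇔
    (λ eq → inverse-injective pτ (trans (sym (lookup-translate σ x)) (trans eq (lookup-translate σ′ x))))
    (λ eq → trans (lookup-translate σ x) (trans (cong (inverse pτ) eq) (sym (lookup-translate σ′ x))))

  dist-id-translate : ∀ σ → dist (idPerm n) (translate σ) ≡ dist τ σ
  dist-id-translate σ = dist-cong (idPerm n) (translate σ) τ σ λ x → mk⇔
    (λ eq → trans (cong (lookup τ) (trans (sym (lookup-idPerm x)) (trans eq (lookup-translate σ x)))) (inverseʳ pτ _))
    (λ eq → trans (lookup-idPerm x)
      (trans (sym (inverseˡ pτ x)) (trans (cong (inverse pτ) eq) (sym (lookup-translate σ x)))))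

  ballInter-≤-translate : ∀ r π → ballInter r π τ ≤ ballInter r (translate π) (idPerm n)
  ballInter-≤-translate r π = ballInter-≤-by-injection r π τ (translate π) (idPerm n) translate
    (λ {σ} (pσ , π-close , τ-close) → translate-IsPerm pσ ,
      subst (_≤ r) (sym (dist-translate π σ)) π-close , subst (_≤ r) (sym (dist-id-translate σ)) τ-close)
    (λ _ _ → translate-injective)


module _ {n : ℕ} (i j : Fin n) where

  transpose-matchˡ : transpose i j i ≡ j
  transpose-matchˡ with i Finₚ.≟ i
  ... | yes _   = refl
  ... | no i≢i  = ⊥-elim (i≢i refl)

  transpose-matchʳ : transpose i j j ≡ i
  transpose-matchʳ with j Finₚ.≟ i
  ... | yes j≡i = j≡i
  ... | no _ with j Finₚ.≟ j
  ...   | yes _  = refl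
  ...   | no j≢j = ⊥-elim (j≢j refl)

  transpose-fix : ∀ {k} → k ≢ i → k ≢ j → transpose i j k ≡ k
  transpose-fix {k} k≢i k≢j with k Finₚ.≟ i
  ... | yes k≡i = ⊥-elim (k≢i k≡i)
  ... | no _ with k Finₚ.≟ j
  ...   | yes k≡j = ⊥-elim (k≢j k≡j)
  ...   | no _    = refl

  transpose-involutive : ∀ k → transpose i j (transpose i j k) ≡ k
  transpose-involutive k with k Finₚ.≟ i
  ... | yes k≡i = trans transpose-matchʳ (sym k≡i)
  ... | no k≢i with k Finₚ.≟ j
  ...   | yes k≡j = trans transpose-matchˡ (sym k≡j)
  ...   | no k≢j  = transpose-fix k≢i k≢j

  transpose-injective : ∀ {k l} → transpose i j k ≡ transpose i j l → k ≡ l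
  transpose-injective {k} {l} eq =
    trans (sym (transpose-involutive k)) (trans (cong (transpose i j) eq) (transpose-involutive l))

  InPair OffPair : Fin n → Set
  InPair  x = x ≡ i ⊎ x ≡ j
  OffPair x = x ≢ i × x ≢ j

  transpose-≡⇔ : ∀ {k l} → (InPair k → OffPair l) → (transpose i j k ≡ l) ⇔ (k ≡ l)
  transpose-≡⇔ {k} {l} avoid with k Finₚ.≟ i
  ... | yes k≡i = mk⇔ (λ j≡l → ⊥-elim (proj₂ (avoid (inj₁ k≡i)) (sym j≡l)))
                      (λ k≡l → ⊥-elim (proj₁ (avoid (inj₁ k≡i)) (trans (sym k≡l) k≡i)))
  ... | no _ with k Finₚ.≟ j
  ...   | yes k≡j = mk⇔ (λ i≡l → ⊥-elim (proj₁ (avoid (inj₂ k≡j)) (sym i≡l)))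
                        (λ k≡l → ⊥-elim (proj₂ (avoid (inj₂ k≡j)) (trans (sym k≡l) k≡j)))
  ...   | no _    = mk⇔ id id

  MapsPairOff : (Fin n → Fin n) → Set
  MapsPairOff f = ∀ x → InPair x → OffPair (f x)

  MapsPairOff⇒preimage-off : ∀ {f} → MapsPairOff f → ∀ x → InPair (f x) → OffPair x
  MapsPairOff⇒preimage-off {f} f-off x fx∈pair =
    (λ x≡i → off (f-off x (inj₁ x≡i))) , (λ x≡j → off (f-off x (inj₂ x≡j)))
    where
    off : ¬ OffPair (f x)
    off (fx≢i , fx≢j) = [ fx≢i , fx≢j ]′ fx∈pair

  transpose∘-fixes⇔ : ∀ {f} → MapsPairOff f → ∀ x → (transpose i j (f x) ≡ x) ⇔ (f x ≡ x)
  transpose∘-fixes⇔ f-off x = transpose-≡⇔ (MapsPairOff⇒preimage-off f-off x)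

ShortCycleAt : ∀ {n} → Perm n → Fin n → Set
ShortCycleAt π i = ∃ λ k → 1 ≤ k × k ≤ 3 × iter k π i ≡ i

-- Splitting a cycle of length at least four

shortCycleAt? : ∀ {n} (π : Perm n) → Decidable (ShortCycleAt π)
shortCycleAt? π i with iter 1 π i Finₚ.≟ i | iter 2 π i Finₚ.≟ i | iter 3 π i Finₚ.≟ i
... | yes eq | _      | _      = yes (1 , s≤s z≤n , s≤s z≤n , eq)
... | no _   | yes eq | _      = yes (2 , s≤s z≤n , s≤s (s≤s z≤n) , eq)
... | no _   | no _   | yes eq = yes (3 , s≤s z≤n , s≤s (s≤s (s≤s z≤n)) , eq)
... | no ¬1  | no ¬2  | no ¬3  = no λ
  { (1 , _ , _ , eq) → ¬1 eq
  ; (2 , _ , _ , eq) → ¬2 eq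
  ; (3 , _ , _ , eq) → ¬3 eq
  ; (suc (suc (suc (suc _))) , _ , s≤s (s≤s (s≤s ())) , _) }

squareFixedCount : ∀ {n} → Perm n → ℕ
squareFixedCount {n} μ = length (filter (λ x → lookup μ (lookup μ x) Finₚ.≟ x) (List.allFin n))

squareFixedCount-≤ : ∀ {n} (μ : Perm n) → squareFixedCount μ ≤ n
squareFixedCount-≤ {n} μ =
  subst (squareFixedCount μ ≤_) (Listₚ.length-tabulate id) (Listₚ.length-filter _ (List.allFin n))

module SplitLongCycle {n : ℕ} {μ : Perm n} (pμ : IsPerm μ) {i : Fin n} (long : ¬ ShortCycleAt μ i) where

  private
    m = lookup μ
    a = m i
    b = m a
    t = transpose i b

    m-injective : ∀ {x y} → m x ≡ m y → x ≡ y
    m-injective = IsPerm-injective pμ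

    a≢i : a ≢ i
    a≢i eq = long (1 , s≤s z≤n , s≤s z≤n , eq)
    b≢i : b ≢ i
    b≢i eq = long (2 , s≤s z≤n , s≤s (s≤s z≤n) , eq)
    mb≢i : m b ≢ i
    mb≢i eq = long (3 , s≤s z≤n , s≤s (s≤s (s≤s z≤n)) , eq)
    a≢b : a ≢ b
    a≢b eq = a≢i (sym (m-injective eq))
    mb≢b : m b ≢ b
    mb≢b eq = a≢b (sym (m-injective eq))

    t-off : ∀ {x} → OffPair i b x → t x ≡ x
    t-off (x≢i , x≢b) = transpose-fix i b x≢i x≢b

    m-moves-pair : MapsPairOff i b m
    m-moves-pair x (inj₁ refl) = a≢i , a≢b
    m-moves-pair x (inj₂ refl) = mb≢i , mb≢b

  μ′ : Perm n
  μ′ = tabulate (t ∘ m)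

  private
    lookup-μ′ : ∀ x → lookup μ′ x ≡ t (m x)
    lookup-μ′ = Vecₚ.lookup∘tabulate (t ∘ m)

  μ′-IsPerm : IsPerm μ′
  μ′-IsPerm = tabulate-IsPerm (m-injective ∘ transpose-injective i b)

  dist-id-μ′ : dist (idPerm n) μ′ ≡ dist (idPerm n) μ
  dist-id-μ′ = dist-id-cong μ′ μ λ x → subst (λ y → (y ≡ x) ⇔ (m x ≡ x)) (sym (lookup-μ′ x))
    (transpose∘-fixes⇔ i b m-moves-pair x)

  squareFixedCount-μ′ : squareFixedCount μ < squareFixedCount μ′
  squareFixedCount-μ′ = length-filter-mono-< P? P′? P⊆P′ (∈-allFin i) P′i (λ Pi → b≢i Pi)
    where
    P? = λ x → m (m x) Finₚ.≟ x
    P′? = λ x → lookup μ′ (lookup μ′ x) Finₚ.≟ x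
    square-fixed-off-pair : ∀ {y} → m (m y) ≡ y → OffPair i b y
    square-fixed-off-pair mmy≡y = (λ { refl → b≢i mmy≡y })
                                 , (λ { refl → b≢i (m-injective (m-injective mmy≡y)) })
    P⊆P′ : ∀ {x} → m (m x) ≡ x → lookup μ′ (lookup μ′ x) ≡ x
    P⊆P′ {x} mmx≡x = begin
      lookup μ′ (lookup μ′ x) ≡⟨ lookup-μ′ _ ⟩
      t (m (lookup μ′ x))     ≡⟨ cong (t ∘ m) (trans (lookup-μ′ x) (t-off (square-fixed-off-pair (cong m mmx≡x)))) ⟩
      t (m (m x))             ≡⟨ cong t mmx≡x ⟩
      t x                     ≡⟨ t-off (square-fixed-off-pair mmx≡x) ⟩
      x                       ∎
      where open ≡-Reasoning
    P′i : lookup μ′ (lookup μ′ i) ≡ i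
    P′i = begin
      lookup μ′ (lookup μ′ i) ≡⟨ cong (lookup μ′) (trans (lookup-μ′ i) (t-off (a≢i , a≢b))) ⟩
      lookup μ′ a             ≡⟨ lookup-μ′ a ⟩
      t b                     ≡⟨ transpose-matchʳ i b ⟩
      i                       ∎
      where open ≡-Reasoning

  module _ {r : ℕ} (on-sphere : dist (idPerm n) μ ≡ 2 * r) where

    private
      module _ {σ : Perm n} (σ-in : InBalls r μ (idPerm n) σ) where
        s = lookup σ
        s-injective : ∀ {x y} → s x ≡ s y → x ≡ y
        s-injective = IsPerm-injective (proj₁ σ-in)
        between : ∀ x → s x ≡ m x ⊎ s x ≡ x
        between = sphere-InBalls⇒between r {μ} on-sphere σ-in

        -- σ either contains the whole cycle of μ through i or fixes all of it
        contains-cycle : s i ≡ a → MapsPairOff i b s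
        contains-cycle si≡a x (inj₁ refl) = subst (OffPair i b) (sym si≡a) (a≢i , a≢b)
        contains-cycle si≡a x (inj₂ refl) with between b
        ... | inj₁ sb≡mb = subst (OffPair i b) (sym sb≡mb) (m-moves-pair b (inj₂ refl))
        ... | inj₂ sb≡b with between a
        ...   | inj₁ sa≡b = ⊥-elim (a≢b (s-injective (trans sa≡b (sym sb≡b))))
        ...   | inj₂ sa≡a = ⊥-elim (a≢i (s-injective (trans sa≡a (sym si≡a))))

        s-fixes-i : s i ≢ a → s i ≡ i
        s-fixes-i si≢a = [ ⊥-elim ∘ si≢a , id ]′ (between i)

        s-a≢b : s i ≢ a → s a ≢ b
        s-a≢b si≢a sa≡b with injective⇒surjective s-injective a
        ... | z , sz≡a with between z
        ...   | inj₁ sz≡mz = si≢a (subst (λ y → s y ≡ a) (m-injective (trans (sym sz≡mz) sz≡a)) sz≡a)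
        ...   | inj₂ sz≡z = a≢b (trans (sym (trans (cong s (trans (sym sz≡a) sz≡z)) sz≡a)) sa≡b)

        avoids-cycle : s i ≢ a → ∀ x → InPair i b (m x) → OffPair i b (s x)
        avoids-cycle si≢a x mx∈pair with between x | mx∈pair
        ... | inj₂ sx≡x  | _        =
          subst (OffPair i b) (sym sx≡x) (MapsPairOff⇒preimage-off i b m-moves-pair x mx∈pair)
        ... | inj₁ sx≡mx | inj₁ mx≡i = ⊥-elim (a≢i (subst (λ y → m y ≡ i) x≡i mx≡i))
          where
          x≡i : x ≡ i
          x≡i = s-injective (trans sx≡mx (trans mx≡i (sym (s-fixes-i si≢a))))
        ... | inj₁ sx≡mx | inj₂ mx≡b =
          ⊥-elim (s-a≢b si≢a (subst (λ y → s y ≡ b) (m-injective mx≡b) (trans sx≡mx mx≡b)))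

        t∘σ : Perm n
        t∘σ = tabulate (t ∘ s)

        lookup-t∘σ : ∀ x → lookup t∘σ x ≡ t (s x)
        lookup-t∘σ = Vecₚ.lookup∘tabulate (t ∘ s)

        t∘σ-at-i : s i ≡ a → lookup t∘σ i ≡ a
        t∘σ-at-i si≡a = trans (lookup-t∘σ i) (trans (cong t si≡a) (t-off (a≢i , a≢b)))

        t∘σ-InBalls : s i ≡ a → InBalls r μ′ (idPerm n) t∘σ
        t∘σ-InBalls si≡a = tabulate-IsPerm (s-injective ∘ transpose-injective i b)
                         , subst (_≤ r) (sym dist-μ′-t∘σ) (proj₁ (proj₂ σ-in))
                         , subst (_≤ r) (sym dist-id-t∘σ) (proj₂ (proj₂ σ-in))
          where
          dist-μ′-t∘σ : dist μ′ t∘σ ≡ dist μ σ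
          dist-μ′-t∘σ = dist-cong μ′ t∘σ μ σ λ x →
            subst₂ (λ y z → (y ≡ z) ⇔ (m x ≡ s x)) (sym (lookup-μ′ x)) (sym (lookup-t∘σ x))
              (mk⇔ (transpose-injective i b) (cong t))
          dist-id-t∘σ : dist (idPerm n) t∘σ ≡ dist (idPerm n) σ
          dist-id-t∘σ = dist-id-cong t∘σ σ λ x → subst (λ y → (y ≡ x) ⇔ (s x ≡ x)) (sym (lookup-t∘σ x))
            (transpose∘-fixes⇔ i b (contains-cycle si≡a) x)

        σ-InBalls : s i ≢ a → InBalls r μ′ (idPerm n) σ
        σ-InBalls si≢a = proj₁ σ-in , subst (_≤ r) (sym dist-μ′-σ) (proj₁ (proj₂ σ-in)) , proj₂ (proj₂ σ-in)
          where
          dist-μ′-σ : dist μ′ σ ≡ dist μ σ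
          dist-μ′-σ = dist-cong μ′ σ μ σ λ x → subst (λ y → (y ≡ s x) ⇔ (m x ≡ s x)) (sym (lookup-μ′ x))
            (transpose-≡⇔ i b (avoids-cycle si≢a x))

    ballInjection : Perm n → Perm n
    ballInjection σ with lookup σ i Finₚ.≟ a
    ... | yes _ = tabulate (t ∘ lookup σ)
    ... | no _  = σ

    ballInjection-InBalls : ∀ {σ} → InBalls r μ (idPerm n) σ → InBalls r μ′ (idPerm n) (ballInjection σ)
    ballInjection-InBalls {σ} σ-in with lookup σ i Finₚ.≟ a
    ... | yes si≡a = t∘σ-InBalls σ-in si≡a
    ... | no si≢a  = σ-InBalls σ-in si≢a

    ballInjection-injective : ∀ {σ σ′} → InBalls r μ (idPerm n) σ → InBalls r μ (idPerm n) σ′ →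
      ballInjection σ ≡ ballInjection σ′ → σ ≡ σ′
    ballInjection-injective {σ} {σ′} σ-in σ′-in eq with lookup σ i Finₚ.≟ a | lookup σ′ i Finₚ.≟ a
    ... | yes _ | yes _ = lookup-ext σ σ′ λ x → transpose-injective i b
          (trans (sym (lookup-t∘σ σ-in x)) (trans (cong (λ v → lookup v x) eq) (lookup-t∘σ σ′-in x)))
    ... | no _ | no _ = eq
    ... | yes si≡a | no s′i≢a = ⊥-elim (a≢i (trans (sym (t∘σ-at-i σ-in si≡a))
          (trans (cong (λ v → lookup v i) eq) (s-fixes-i σ′-in s′i≢a))))
    ... | no si≢a | yes s′i≡a = ⊥-elim (a≢i (trans (sym (t∘σ-at-i σ′-in s′i≡a))
          (trans (cong (λ v → lookup v i) (sym eq)) (s-fixes-i σ-in si≢a))))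

    ballInter-≤-μ′ : ballInter r μ (idPerm n) ≤ ballInter r μ′ (idPerm n)
    ballInter-≤-μ′ = ballInter-≤-by-injection r μ (idPerm n) μ′ (idPerm n)
      ballInjection ballInjection-InBalls ballInjection-injective

ShortCycleImprovement : ∀ {n} → ℕ → Perm n → Set
ShortCycleImprovement {n} r μ = Σ (Perm n) λ ρ →
  IsPerm ρ × ShortCycles ρ × dist (idPerm n) ρ ≡ 2 * r × ballInter r μ (idPerm n) ≤ ballInter r ρ (idPerm n)

-- The fuel k bounds the number of splittings: each one raises squareFixedCount, which never exceeds n.
shortCycleImprovement : ∀ {n} r k (μ : Perm n) → IsPerm μ → dist (idPerm n) μ ≡ 2 * r →
  n ≤ squareFixedCount μ + k → ShortCycleImprovement r μ
shortCycleImprovement {n} r k μ pμ on-sphere fuel with Finₚ.all? (shortCycleAt? μ)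
... | yes short = μ , pμ , short , on-sphere , ≤-refl
... | no ¬short = split k fuel
  where
  module S = SplitLongCycle pμ (proj₂ (Finₚ.¬∀⟶∃¬ n _ (shortCycleAt? μ) ¬short))
  split : ∀ k → n ≤ squareFixedCount μ + k → ShortCycleImprovement r μ
  split zero fuel = ⊥-elim (<⇒≱ S.squareFixedCount-μ′
    (≤-trans (squareFixedCount-≤ S.μ′) (subst (n ≤_) (+-identityʳ _) fuel)))
  split (suc k) fuel with shortCycleImprovement r k S.μ′ S.μ′-IsPerm (trans S.dist-id-μ′ on-sphere)
    (≤-trans fuel (subst (_≤ squareFixedCount S.μ′ + k) (sym (+-suc _ k)) (+-monoˡ-≤ k S.squareFixedCount-μ′)))
  ... | ρ , pρ , short , ρ-on-sphere , μ′≤ρ =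
    ρ , pρ , short , ρ-on-sphere , ≤-trans (S.ballInter-≤-μ′ on-sphere) μ′≤ρ

-- A product of r disjoint transpositions

pairSwap : ℕ → ℕ → ℕ
pairSwap zero    m                   = m
pairSwap (suc r) zero                = 1
pairSwap (suc r) (suc zero)          = 0
pairSwap (suc r) (suc (suc m))       = suc (suc (pairSwap r m))

pairSwap-involutive : ∀ r m → pairSwap r (pairSwap r m) ≡ m
pairSwap-involutive zero    m             = refl
pairSwap-involutive (suc r) zero          = refl
pairSwap-involutive (suc r) (suc zero)    = refl
pairSwap-involutive (suc r) (suc (suc m)) = cong (suc ∘ suc) (pairSwap-involutive r m)

pairSwap-fixed⇒≥ : ∀ r m → pairSwap r m ≡ m → 2 * r ≤ m
pairSwap-fixed⇒≥ zero    m             _  = z≤n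
pairSwap-fixed⇒≥ (suc r) (suc (suc m)) eq rewrite *-suc 2 r =
  s≤s (s≤s (pairSwap-fixed⇒≥ r m (suc-injective (suc-injective eq))))

pairSwap-≥⇒fixed : ∀ r m → 2 * r ≤ m → pairSwap r m ≡ m
pairSwap-≥⇒fixed zero    m             _ = refl
pairSwap-≥⇒fixed (suc r) (suc zero)    2r+2≤1 with subst (_≤ 1) (*-suc 2 r) 2r+2≤1
... | s≤s ()
pairSwap-≥⇒fixed (suc r) (suc (suc m)) 2r+2≤m rewrite *-suc 2 r =
  cong (suc ∘ suc) (pairSwap-≥⇒fixed r m (s≤s⁻¹ (s≤s⁻¹ 2r+2≤m)))

pairSwap-< : ∀ r {m n} → 2 * r ≤ n → m < n → pairSwap r m < n
pairSwap-< zero    _ m<n = m<n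
pairSwap-< (suc r) {zero}        2r+2≤n _ rewrite *-suc 2 r = ≤-trans (s≤s (s≤s z≤n)) 2r+2≤n
pairSwap-< (suc r) {suc zero}    2r+2≤n m<n = ≤-trans (s≤s z≤n) m<n
pairSwap-< (suc r) {suc (suc m)} {suc (suc n)} 2r+2≤n (s≤s (s≤s m<n)) rewrite *-suc 2 r =
  s≤s (s≤s (pairSwap-< r (s≤s⁻¹ (s≤s⁻¹ 2r+2≤n)) m<n))

module _ (r n : ℕ) (2r≤n : 2 * r ≤ n) where

  pairSwapPerm : Perm n
  pairSwapPerm = tabulate (λ x → Fin.fromℕ< (pairSwap-< r 2r≤n (Finₚ.toℕ<n x)))

  private
    toℕ-lookup : ∀ x → toℕ (lookup pairSwapPerm x) ≡ pairSwap r (toℕ x)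
    toℕ-lookup x = trans (cong toℕ (Vecₚ.lookup∘tabulate _ x)) (Finₚ.toℕ-fromℕ< _)

    fixed⇔ : ∀ x → lookup pairSwapPerm x ≡ x ⇔ 2 * r ≤ toℕ x
    fixed⇔ x = mk⇔
      (λ eq → pairSwap-fixed⇒≥ r (toℕ x) (trans (sym (toℕ-lookup x)) (cong toℕ eq)))
      (λ 2r≤x → Finₚ.toℕ-injective (trans (toℕ-lookup x) (pairSwap-≥⇒fixed r (toℕ x) 2r≤x)))

  pairSwapPerm-IsPerm : IsPerm pairSwapPerm
  pairSwapPerm-IsPerm = tabulate-IsPerm λ {x} {y} eq → Finₚ.toℕ-injective (begin
    toℕ x                                 ≡⟨ pairSwap-involutive r (toℕ x) ⟨
    pairSwap r (pairSwap r (toℕ x))       ≡⟨ cong (pairSwap r) (Finₚ.toℕ-fromℕ< _) ⟨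
    pairSwap r (toℕ (Fin.fromℕ< _))       ≡⟨ cong (pairSwap r ∘ toℕ) eq ⟩
    pairSwap r (toℕ (Fin.fromℕ< _))       ≡⟨ cong (pairSwap r) (Finₚ.toℕ-fromℕ< _) ⟩
    pairSwap r (pairSwap r (toℕ y))       ≡⟨ pairSwap-involutive r (toℕ y) ⟩
    toℕ y                                 ∎)
    where open ≡-Reasoning

  pairSwapPerm-ShortCycles : ShortCycles pairSwapPerm
  pairSwapPerm-ShortCycles x = 2 , s≤s z≤n , s≤s (s≤s z≤n) , Finₚ.toℕ-injective (begin
    toℕ (lookup pairSwapPerm (lookup pairSwapPerm x)) ≡⟨ toℕ-lookup _ ⟩
    pairSwap r (toℕ (lookup pairSwapPerm x))          ≡⟨ cong (pairSwap r) (toℕ-lookup x) ⟩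
    pairSwap r (pairSwap r (toℕ x))                   ≡⟨ pairSwap-involutive r (toℕ x) ⟩
    toℕ x                                             ∎)
    where open ≡-Reasoning

  dist-id-pairSwapPerm : dist (idPerm n) pairSwapPerm ≡ 2 * r
  dist-id-pairSwapPerm = length-filter-tabulate-initial _ id 2r≤n
    (λ x moved → ≰⇒> λ 2r≤x → moved (trans (lookup-idPerm x) (sym (Equivalence.from (fixed⇔ x) 2r≤x))))
    (λ x x<2r fixed → <⇒≱ x<2r (Equivalence.to (fixed⇔ x) (trans (sym fixed) (lookup-idPerm x))))

∈⇒≤maxList : ∀ {x xs} → x ∈ xs → x ≤ maxList xs
∈⇒≤maxList {x} {xs} x∈xs = Listₚ.foldr-preservesᵒ {P = x ≤_}
  (λ a b → [ m≤n⇒m≤n⊔o b , m≤n⇒m≤o⊔n a ]′) 0 xs (inj₂ (Any.map (λ { refl → ≤-refl }) x∈xs))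

maxList-∈-0∷ : ∀ xs → maxList xs ∈ 0 ∷ xs
maxList-∈-0∷ xs = Listₚ.foldr-preservesᵇ ⊔-closed (here refl) (All.tabulate there)
  where
  ⊔-closed : ∀ {a b} → a ∈ 0 ∷ xs → b ∈ 0 ∷ xs → a ⊔ b ∈ 0 ∷ xs
  ⊔-closed {a} {b} a∈ b∈ with ⊔-sel a b
  ... | inj₁ a⊔b≡a = subst (_∈ 0 ∷ xs) (sym a⊔b≡a) a∈
  ... | inj₂ a⊔b≡b = subst (_∈ 0 ∷ xs) (sym a⊔b≡b) b∈

maxList-∈ : ∀ {x xs} → x ∈ xs → maxList xs ∈ xs
maxList-∈ {x} {xs} x∈xs with maxList-∈-0∷ xs
... | there max∈xs = max∈xs
... | here max≡0 = subst (_∈ xs) x≡max x∈xs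
  where
  x≡max : x ≡ maxList xs
  x≡max = trans (n≤0⇒n≡0 (subst (x ≤_) max≡0 (∈⇒≤maxList x∈xs))) (sym max≡0)

module _ {n : ℕ} (d r : ℕ) where

  private
    pairs : List (Perm n × Perm n)
    pairs = filter (λ p → dist (proj₁ p) (proj₂ p) ≟ d) (List.cartesianProduct (SymList n) (SymList n))

    value : Perm n × Perm n → ℕ
    value (π , τ) = ballInter r π τ

    ∈-pairs⁺ : ∀ {π τ} → IsPerm π → IsPerm τ → dist π τ ≡ d → (π , τ) ∈ pairs
    ∈-pairs⁺ pπ pτ dπτ = ∈-filter⁺ _ (∈-cartesianProduct⁺ (∈-SymList⁺ pπ) (∈-SymList⁺ pτ)) dπτ

  ballInter-≤-I : ∀ {π τ} → IsPerm π → IsPerm τ → dist π τ ≡ d → ballInter r π τ ≤ I n d r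
  ballInter-≤-I pπ pτ dπτ = ∈⇒≤maxList (∈-map⁺ value (∈-pairs⁺ pπ pτ dπτ))

  I-attained : ∀ {π₀ τ₀} → IsPerm π₀ → IsPerm τ₀ → dist π₀ τ₀ ≡ d →
    ∃₂ λ π τ → IsPerm π × IsPerm τ × dist π τ ≡ d × I n d r ≡ ballInter r π τ
  I-attained pπ₀ pτ₀ dπ₀τ₀ with ∈-map⁻ value (maxList-∈ (∈-map⁺ value (∈-pairs⁺ pπ₀ pτ₀ dπ₀τ₀)))
  ... | (π , τ) , pair∈ , I≡ with ∈-filter⁻ _ {xs = List.cartesianProduct (SymList n) (SymList n)} pair∈
  ...   | pair∈product , dπτ with ∈-cartesianProduct⁻ (SymList n) (SymList n) pair∈product
  ...     | π∈ , τ∈ = π , τ , ∈-SymList⁻ π∈ , ∈-SymList⁻ τ∈ , dπτ , I≡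

lemma9 : (r n : ℕ) → 2 ≤ n → 2 * r ≤ n →
    Σ (Vec (Fin n) n) λ π →
      IsPerm π × ShortCycles π × I n (2 * r) r ≡ ballInter r π (idPerm n)
-- The argument does not need the hypothesis 2 ≤ n.
lemma9 r n _ 2r≤n with I-attained (2 * r) r idPerm-IsPerm (pairSwapPerm-IsPerm r n 2r≤n)
                         (dist-id-pairSwapPerm r n 2r≤n)
... | π , τ , pπ , pτ , dπτ , I≡πτ
    with shortCycleImprovement r n (translate pτ π) (translate-IsPerm pτ pπ)
           (trans (dist-id-translate pτ π) (trans (dist-sym τ π) dπτ)) (m≤n+m n _)
... | ρ , pρ , short , ρ-on-sphere , μ≤ρ = ρ , pρ , short , ≤-antisym
    (begin
      I n (2 * r) r                           ≡⟨ I≡πτ ⟩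
      ballInter r π τ                         ≤⟨ ballInter-≤-translate pτ r π ⟩
      ballInter r (translate pτ π) (idPerm n) ≤⟨ μ≤ρ ⟩
      ballInter r ρ (idPerm n)                ∎)
    (ballInter-≤-I (2 * r) r pρ idPerm-IsPerm (trans (dist-sym ρ (idPerm n)) ρ-on-sphere))
  where open ≤-Reasoning
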